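{- Let $n\ge 1$ and $m\ge 1$ be integers, and let $\mathfrak{M}$ be a structure with universe $\{a_0,\dots,a_{n-1}\}$ of size $n$ and a binary function $+$ defined by $a_k+a_l=a_{(k+l)\bmod n}$. Then the value of the strategic IF game $\Gamma(\mathfrak{M},\phi_m)$ equals the probability that a uniformly random sample of $m$ elements drawn with replacement from a set of $n$ elements contains at least one pair of duplicates.
   Context: The IF sentence is $\phi_m = \forall x_0 (\forall x_1/X_1)\cdots(\forall x_{m-1}/X_{m-1})(\exists x_m/X_m)\cdots(\exists x_{2m-1}/X_{2m-1})\,\psi_m$, where $X_k=\{x_0,\dots,x_{k-1}\}$ and $\psi_m=\bigvee_{0\le i<m}\bigvee_{i<j<m}\big((x_i+x_{i+m})=(x_j+x_{j+m})\big)$. Its strategic game $\Gamma(\mathfrak{M},\phi_m)$ is the following finite two-player win-loss zero-sum game. Since each quantifier $(Qx_k/X_k)$ must be chosen independently of all earlier variables, a pure strategy of Abelard is a tuple $(c_0,\dots,c_{m-1})\in M^m$ (values of $x_0,\dots,x_{m-1}$), and a pure strategy of Eloise consists of a tuple $(c_m,\dots,c_{2m-1})\in M^m$ (values of $x_m,\dots,x_{2m-1}$) together with a function that, given all values of $x_0,\dots,x_{2m-1}$, selects a disjunct of $\psi_m$ (disjunctions are Eloise's moves, made with knowledge of all variable values). Eloise receives payoff $1$ if the selected disjunct is true under the chosen values and $0$ otherwise; Abelard receives $1$ minus that. Mixed strategies are probability distributions over pure strategies, and the value of the game is $\max_\mu\min_\nu U(\mu,\nu)$, where $U$ is Eloise's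 expected payoff; this is the value of $\phi_m$ on $\mathfrak{M}$.
   Formalization: The mixed strategies of Abelard and Eloise are probability distributions with rational weights. -}

module Defs where

open import Data.Nat as ℕ using (ℕ; zero; suc; _^_; NonZero)
open import Data.Nat.DivMod using (_%_; m%n<n)
open import Data.Nat.Properties using (m^n≢0)
open import Data.Fin as Fin using (Fin; toℕ; fromℕ<; _≟_; _<?_)
open import Data.Vec as Vec using (Vec; []; _∷_)
open import Data.List as List using (List; []; _∷_; [_]; concatMap; allFin; filter; length; map)
open import Data.List.Relation.Unary.All using (All)
open import Data.Bool using (Bool; true; false; _∨_; _∧_; if_then_else_)
open import Data.Product using (Σ; ∃; _×_; _,_; proj₁; proj₂)
open import Data.Integer using (+_)
open import Data.Rational as ℚ using (ℚ; 0ℚ; 1ℚ; _/_)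
open import Relation.Nullary.Decidable using (⌊_⌋)
open import Relation.Binary.PropositionalEquality using (_≡_)

_⊕_ : ∀ {n} .{{_ : NonZero n}} → Fin n → Fin n → Fin n
_⊕_ {n} k l = fromℕ< (m%n<n (toℕ k ℕ.+ toℕ l) n)

-- The game Γ(𝔐, φ_m).
-- Abelard's pure strategy: values (c_0,…,c_{m-1}) of x_0,…,x_{m-1}.

AbelardPure : ℕ → ℕ → Set
AbelardPure n m = Fin m → Fin n

-- A disjunct of ψ_m is named by a pair (i , j) of indices.  Only pairs
-- with i < j are genuine disjuncts of ψ_m; choosing a pair with i ≥ j
-- counts as choosing a false formula.

Disjunct : ℕ → Set
Disjunct m = Fin m × Fin m

-- Eloise's pure strategy: values (c_m,…,c_{2m-1}) of x_m,…,x_{2m-1},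
-- plus a disjunct selector depending on all values of x_0,…,x_{2m-1}
-- (given as Abelard's tuple and Eloise's tuple).

EloisePure : ℕ → ℕ → Set
EloisePure n m = (Fin m → Fin n) × ((Fin m → Fin n) → (Fin m → Fin n) → Disjunct m)

-- Truth of the disjunct (x_i + x_{i+m}) = (x_j + x_{j+m}) (for i < j).
disjTrue : ∀ {n m} .{{_ : NonZero n}} →
           (Fin m → Fin n) → (Fin m → Fin n) → Disjunct m → Bool
disjTrue a e (i , j) = ⌊ i <? j ⌋ ∧ ⌊ (a i ⊕ e i) ≟ (a j ⊕ e j) ⌋

payoff : ∀ {n m} .{{_ : NonZero n}} → EloisePure n m → AbelardPure n m → ℚ
payoff (e , sel) a = if disjTrue a e (sel a e) then 1ℚ else 0ℚ

Mixed : Set → Set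
Mixed S = List (ℚ × S)

sumℚ : List ℚ → ℚ
sumℚ = List.foldr ℚ._+_ 0ℚ

IsDistribution : {S : Set} → Mixed S → Set
IsDistribution μ = All (λ p → 0ℚ ℚ.≤ proj₁ p) μ × sumℚ (map proj₁ μ) ≡ 1ℚ

U : ∀ {n m} .{{_ : NonZero n}} → Mixed (EloisePure n m) → Mixed (AbelardPure n m) → ℚ
U μ ν = sumℚ (map (λ p → sumℚ (map (λ q → proj₁ p ℚ.* proj₁ q ℚ.* payoff (proj₂ p) (proj₂ q)) ν)) μ)

-- "v is the value max_μ min_ν U(μ,ν)": the maximum is attained by some
-- μ guaranteeing v against every ν, and no μ guarantees more than v.
IsValue : (n m : ℕ) .{{_ : NonZero n}} → ℚ → Set
IsValue n m v =
  (Σ (Mixed (EloisePure n m)) λ μ → IsDistribution μ ×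
     ((ν : Mixed (AbelardPure n m)) → IsDistribution ν → v ℚ.≤ U μ ν))
  × ((μ : Mixed (EloisePure n m)) → IsDistribution μ →
     Σ (Mixed (AbelardPure n m)) λ ν → IsDistribution ν × U μ ν ℚ.≤ v)

allSeqs : (n m : ℕ) → List (Vec (Fin n) m)
allSeqs n zero = [ [] ]
allSeqs n (suc m) = concatMap (λ x → map (x ∷_) (allSeqs n m)) (allFin n)

anyEq : ∀ {n k} → Fin n → Vec (Fin n) k → Bool
anyEq x [] = false
anyEq x (y ∷ ys) = ⌊ x ≟ y ⌋ ∨ anyEq x ys

hasDup : ∀ {n k} → Vec (Fin n) k → Bool
hasDup [] = false
hasDup (x ∷ xs) = anyEq x xs ∨ hasDup xs

dupCount : ℕ → ℕ → ℕ
dupCount n m = length (List.filter (λ s → hasDup s ≟B true) (allSeqs n m))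
  where open import Data.Bool.Properties using () renaming (_≟_ to _≟B_)

dupProb : (n m : ℕ) .{{_ : NonZero n}} → ℚ
dupProb n m = _/_ (+ dupCount n m) (n ^ m) {{m^n≢0 n m}}

-- Let v = (c_k + c_{k+m})_{k<m} be the vector whose entries the disjuncts of
-- ψ_m compare.  Translation by a fixed tuple permutes (ℤ/n)^m, so v is uniformly
-- distributed as soon as either player's tuple is.  If Eloise plays her tuple
-- uniformly and names a duplicate pair of v whenever there is one, she therefore
-- wins with exactly the birthday probability against every Abelard; if Abelard
-- plays uniformly, Eloise can only win when v has a duplicate, which happens
-- with that same probability whatever she does.  The two uniform strategies
-- thus form a saddle point.
module Submission where

open import Defs

open import Algebra.Bundles using (CommutativeMonoid)
open import Data.Bool using (Bool; true; false; _∨_; if_then_else_)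
open import Data.Bool.Properties using (∨-zeroʳ) renaming (_≟_ to _≟B_)
open import Data.Empty using (⊥-elim)
open import Data.Fin as Fin using (Fin; toℕ; fromℕ<) renaming (_≟_ to _≟F_)
import Data.Fin.Properties as FinP
open import Data.Fin.Permutation using (Permutation′; permutation)
open import Data.Integer as ℤ using (+_)
import Data.Integer.Properties as ℤP
open import Data.Integer.Tactic.RingSolver using (solve-∀)
open import Data.List as List using (List; []; _∷_; _++_; concatMap; allFin; filter; length; map)
import Data.List.Properties as ListP
open import Data.List.Relation.Unary.All using (All; []; _∷_)
open import Data.Nat as ℕ using (ℕ; NonZero; _≤_; zero; suc; _^_; _∸_)
open import Data.Nat.DivMod using (_%_; m%n<n; m%n%n≡m%n; %-distribˡ-+; [m+n]%n≡m%n; m<n⇒m%n≡m)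
import Data.Nat.Properties as ℕP
open import Data.Product using (∃; _×_; _,_; proj₁; proj₂)
open import Data.Rational as ℚ using (ℚ; 0ℚ; 1ℚ; _/_; fromℚᵘ)
import Data.Rational.Properties as ℚP
open import Data.Rational.Unnormalised as ℚᵘ using (mkℚᵘ; *≡*)
import Data.Rational.Unnormalised.Properties as ℚᵘP
open import Data.Vec using (Vec; _∷_; lookup; tabulate)
import Data.Vec.Properties as VecP
open import Function using (_∘_)
open import Relation.Binary.PropositionalEquality
open import Relation.Nullary using (yes; no)

open import Algebra.Properties.CommutativeMonoid.Sum ℚP.+-0-commutativeMonoid
  using (sum; sum-permute)
open import Algebra.Properties.CommutativeSemigroup
  (CommutativeMonoid.commutativeSemigroup ℚP.+-0-commutativeMonoid) using (interchange)

nat : ℕ → ℚ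
nat c = + c / 1

fromℚᵘ-homo-+ : ∀ p q → fromℚᵘ (p ℚᵘ.+ q) ≡ fromℚᵘ p ℚ.+ fromℚᵘ q
fromℚᵘ-homo-+ p q = ℚP.toℚᵘ-injective (ℚᵘP.≃-trans (ℚP.toℚᵘ-fromℚᵘ (p ℚᵘ.+ q))
  (ℚᵘP.≃-sym (ℚᵘP.≃-trans (ℚP.toℚᵘ-homo-+ (fromℚᵘ p) (fromℚᵘ q))
    (ℚᵘP.+-cong (ℚP.toℚᵘ-fromℚᵘ p) (ℚP.toℚᵘ-fromℚᵘ q)))))

fromℚᵘ-homo-* : ∀ p q → fromℚᵘ (p ℚᵘ.* q) ≡ fromℚᵘ p ℚ.* fromℚᵘ q
fromℚᵘ-homo-* p q = ℚP.toℚᵘ-injective (ℚᵘP.≃-trans (ℚP.toℚᵘ-fromℚᵘ (p ℚᵘ.* q))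
  (ℚᵘP.≃-sym (ℚᵘP.≃-trans (ℚP.toℚᵘ-homo-* (fromℚᵘ p) (fromℚᵘ q))
    (ℚᵘP.*-cong (ℚP.toℚᵘ-fromℚᵘ p) (ℚP.toℚᵘ-fromℚᵘ q)))))

nat-suc : ∀ c → nat (suc c) ≡ 1ℚ ℚ.+ nat c
nat-suc c = trans
  (ℚP.fromℚᵘ-cong {mkℚᵘ (+ suc c) 0} {mkℚᵘ (+ 1) 0 ℚᵘ.+ mkℚᵘ (+ c) 0} (*≡* (cross (+ c))))
  (fromℚᵘ-homo-+ (mkℚᵘ (+ 1) 0) (mkℚᵘ (+ c) 0))
  where
  cross : ∀ c → (+ 1 ℤ.+ c) ℤ.* (+ 1 ℤ.* + 1) ≡ (+ 1 ℤ.* + 1 ℤ.+ c ℤ.* + 1) ℤ.* + 1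
  cross = solve-∀

/-as-scaling : ∀ c N .{{_ : NonZero N}} → + c / N ≡ (+ 1 / N) ℚ.* nat c
/-as-scaling c N@(suc d) = trans
  (ℚP.fromℚᵘ-cong {mkℚᵘ (+ c) d} {mkℚᵘ (+ 1) d ℚᵘ.* mkℚᵘ (+ c) 0} (*≡* (cross (+ c) (+ N))))
  (fromℚᵘ-homo-* (mkℚᵘ (+ 1) d) (mkℚᵘ (+ c) 0))
  where
  cross : ∀ c N → c ℤ.* (N ℤ.* + 1) ≡ (+ 1 ℤ.* c) ℤ.* N
  cross = solve-∀

1/N*N≡1 : ∀ N .{{_ : NonZero N}} → (+ 1 / N) ℚ.* nat N ≡ 1ℚ
1/N*N≡1 N@(suc d) = trans (sym (/-as-scaling N N))
  (ℚP.fromℚᵘ-cong {mkℚᵘ (+ N) d} {mkℚᵘ (+ 1) 0} (*≡* (ℤP.*-comm (+ N) (+ 1))))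

0≤1/N : ∀ N .{{_ : NonZero N}} → 0ℚ ℚ.≤ + 1 / N
0≤1/N N = ℚP.nonNegative⁻¹ _ {{ℚP.normalize-nonNeg 1 N}}

𝟙 : Bool → ℚ
𝟙 b = if b then 1ℚ else 0ℚ

𝟙-mono : ∀ {b c} → (b ≡ true → c ≡ true) → 𝟙 b ℚ.≤ 𝟙 c
𝟙-mono {false} {false} _ = ℚP.≤-refl
𝟙-mono {false} {true}  _ = ℚP.nonNegative⁻¹ 1ℚ
𝟙-mono {true}  {c}     b⇒c rewrite b⇒c refl = ℚP.≤-refl

-- Sums and expectations

∑ : {A : Set} → List A → (A → ℚ) → ℚ
∑ L f = sumℚ (map f L)

infix 6 ∑
syntax ∑ L (λ x → f) = ∑[ x ∈ L ] f

module _ {A : Set} where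

  ∑-cong : (L : List A) {f g : A → ℚ} → (∀ x → f x ≡ g x) → ∑ L f ≡ ∑ L g
  ∑-cong []      f≗g = refl
  ∑-cong (x ∷ L) f≗g = cong₂ ℚ._+_ (f≗g x) (∑-cong L f≗g)

  ∑-map : {B : Set} (L : List A) (h : A → B) (f : B → ℚ) → ∑ (map h L) f ≡ ∑ L (f ∘ h)
  ∑-map []      h f = refl
  ∑-map (x ∷ L) h f = cong (f (h x) ℚ.+_) (∑-map L h f)

  ∑-++ : (xs ys : List A) (f : A → ℚ) → ∑ (xs ++ ys) f ≡ ∑ xs f ℚ.+ ∑ ys f
  ∑-++ []       ys f = sym (ℚP.+-identityˡ _)
  ∑-++ (x ∷ xs) ys f = trans (cong (f x ℚ.+_) (∑-++ xs ys f)) (sym (ℚP.+-assoc (f x) _ _))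

  ∑-concatMap : {B : Set} (L : List B) (g : B → List A) (f : A → ℚ) →
                ∑ (concatMap g L) f ≡ ∑[ y ∈ L ] ∑ (g y) f
  ∑-concatMap []      g f = refl
  ∑-concatMap (y ∷ L) g f =
    trans (∑-++ (g y) (concatMap g L) f) (cong (∑ (g y) f ℚ.+_) (∑-concatMap L g f))

  ∑-*ˡ : (L : List A) (c : ℚ) (f : A → ℚ) → ∑[ x ∈ L ] c ℚ.* f x ≡ c ℚ.* ∑ L f
  ∑-*ˡ []      c f = sym (ℚP.*-zeroʳ c)
  ∑-*ˡ (x ∷ L) c f = trans (cong (c ℚ.* f x ℚ.+_) (∑-*ˡ L c f)) (sym (ℚP.*-distribˡ-+ c (f x) _))

  ∑-distrib-+ : (L : List A) (f g : A → ℚ) → ∑[ x ∈ L ] (f x ℚ.+ g x) ≡ ∑ L f ℚ.+ ∑ L g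
  ∑-distrib-+ []      f g = refl
  ∑-distrib-+ (x ∷ L) f g = trans (cong (f x ℚ.+ g x ℚ.+_) (∑-distrib-+ L f g))
                                  (interchange (f x) (g x) (∑ L f) (∑ L g))

  ∑-zero : (L : List A) → ∑[ x ∈ L ] 0ℚ ≡ 0ℚ
  ∑-zero []      = refl
  ∑-zero (x ∷ L) = trans (ℚP.+-identityˡ _) (∑-zero L)

  ∑-mono : {P : A → Set} (L : List A) {f g : A → ℚ} → All P L →
           (∀ x → P x → f x ℚ.≤ g x) → ∑ L f ℚ.≤ ∑ L g
  ∑-mono []      []       f≤g = ℚP.≤-refl
  ∑-mono (x ∷ L) (px ∷ pL) f≤g = ℚP.+-mono-≤ (f≤g x px) (∑-mono L pL f≤g)

  ∑-const : (L : List A) (c : ℚ) → ∑[ x ∈ L ] c ≡ c ℚ.* nat (length L)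
  ∑-const []      c = sym (ℚP.*-zeroʳ c)
  ∑-const (x ∷ L) c = begin
    c ℚ.+ (∑[ x ∈ L ] c)              ≡⟨ cong₂ ℚ._+_ (sym (ℚP.*-identityʳ c)) (∑-const L c) ⟩
    c ℚ.* 1ℚ ℚ.+ c ℚ.* nat (length L) ≡⟨ ℚP.*-distribˡ-+ c 1ℚ _ ⟨
    c ℚ.* (1ℚ ℚ.+ nat (length L))     ≡⟨ cong (c ℚ.*_) (nat-suc (length L)) ⟨
    c ℚ.* nat (suc (length L))        ∎
    where open ≡-Reasoning

  ∑-𝟙 : (L : List A) (P : A → Bool) →
        ∑[ x ∈ L ] 𝟙 (P x) ≡ nat (length (filter (λ x → P x ≟B true) L))
  ∑-𝟙 []      P = refl
  ∑-𝟙 (x ∷ L) P with P x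
  ... | true  = trans (cong (1ℚ ℚ.+_) (∑-𝟙 L P))
                      (sym (nat-suc (length (filter (λ x → P x ≟B true) L))))
  ... | false = trans (ℚP.+-identityˡ _) (∑-𝟙 L P)

∑-comm : {A B : Set} (L : List A) (M : List B) (f : A → B → ℚ) →
         ∑[ x ∈ L ] ∑[ y ∈ M ] f x y ≡ ∑[ y ∈ M ] ∑[ x ∈ L ] f x y
∑-comm []      M f = sym (∑-zero M)
∑-comm (x ∷ L) M f = trans (cong (∑ M (f x) ℚ.+_) (∑-comm L M f))
                           (sym (∑-distrib-+ M (f x) (λ y → ∑[ x ∈ L ] f x y)))

length-concatMap-const : {A B : Set} (L : List A) (g : A → List B) {k : ℕ} →
                         (∀ x → length (g x) ≡ k) → length (concatMap g L) ≡ length L ℕ.* k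
length-concatMap-const []      g |g|≡k = refl
length-concatMap-const (x ∷ L) g |g|≡k =
  trans (ListP.length-++ (g x)) (cong₂ ℕ._+_ (|g|≡k x) (length-concatMap-const L g |g|≡k))

𝔼 : {A : Set} → Mixed A → (A → ℚ) → ℚ
𝔼 μ f = ∑[ p ∈ μ ] proj₁ p ℚ.* f (proj₂ p)

module _ {A : Set} where

  𝔼-mono : (μ : Mixed A) → IsDistribution μ → {f g : A → ℚ} →
           (∀ x → f x ℚ.≤ g x) → 𝔼 μ f ℚ.≤ 𝔼 μ g
  𝔼-mono μ (0≤w , _) f≤g =
    ∑-mono μ 0≤w (λ (w , x) 0≤w → ℚP.*-monoˡ-≤-nonNeg w {{ℚ.nonNegative 0≤w}} (f≤g x))

  𝔼-const : (μ : Mixed A) → IsDistribution μ → (v : ℚ) → 𝔼 μ (λ _ → v) ≡ v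
  𝔼-const μ (_ , ∑w≡1) v = begin
    ∑[ p ∈ μ ] proj₁ p ℚ.* v ≡⟨ ∑-cong μ (λ p → ℚP.*-comm (proj₁ p) v) ⟩
    ∑[ p ∈ μ ] v ℚ.* proj₁ p ≡⟨ ∑-*ˡ μ v proj₁ ⟩
    v ℚ.* ∑ μ proj₁          ≡⟨ cong (v ℚ.*_) ∑w≡1 ⟩
    v ℚ.* 1ℚ                 ≡⟨ ℚP.*-identityʳ v ⟩
    v                        ∎
    where open ≡-Reasoning

  𝔼-lowerBound : (μ : Mixed A) → IsDistribution μ → {v : ℚ} {f : A → ℚ} →
                 (∀ x → v ℚ.≤ f x) → v ℚ.≤ 𝔼 μ f
  𝔼-lowerBound μ dist {v} v≤f =
    ℚP.≤-trans (ℚP.≤-reflexive (sym (𝔼-const μ dist v))) (𝔼-mono μ dist v≤f)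

  𝔼-upperBound : (μ : Mixed A) → IsDistribution μ → {v : ℚ} {f : A → ℚ} →
                 (∀ x → f x ℚ.≤ v) → 𝔼 μ f ℚ.≤ v
  𝔼-upperBound μ dist {v} f≤v =
    ℚP.≤-trans (𝔼-mono μ dist f≤v) (ℚP.≤-reflexive (𝔼-const μ dist v))

-- U μ ν unfolds to 𝔼₂ μ ν payoff.
𝔼₂ : {A B : Set} → Mixed A → Mixed B → (A → B → ℚ) → ℚ
𝔼₂ μ ν f = ∑[ p ∈ μ ] ∑[ q ∈ ν ] proj₁ p ℚ.* proj₁ q ℚ.* f (proj₂ p) (proj₂ q)

module _ {A B : Set} (μ : Mixed A) (ν : Mixed B) (f : A → B → ℚ) where

  𝔼₂-iterateˡ : 𝔼₂ μ ν f ≡ 𝔼 μ (λ x → 𝔼 ν (f x))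
  𝔼₂-iterateˡ = ∑-cong μ λ (w , x) →
    trans (∑-cong ν (λ (w′ , y) → ℚP.*-assoc w w′ (f x y))) (∑-*ˡ ν w _)

  𝔼₂-iterateʳ : 𝔼₂ μ ν f ≡ 𝔼 ν (λ y → 𝔼 μ (λ x → f x y))
  𝔼₂-iterateʳ = trans (∑-comm μ ν _) (∑-cong ν λ (w′ , y) →
    trans (∑-cong μ (λ (w , x) → trans (cong (ℚ._* f x y) (ℚP.*-comm w w′)) (ℚP.*-assoc w′ w (f x y))))
          (∑-*ˡ μ w′ _))

module _ {A : Set} (N : ℕ) .{{_ : NonZero N}} where

  uniform : List A → Mixed A
  uniform = map (λ x → (+ 1 / N , x))

  𝔼-uniform : (L : List A) (f : A → ℚ) → 𝔼 (uniform L) f ≡ (+ 1 / N) ℚ.* ∑ L f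
  𝔼-uniform L f = trans (∑-map L _ _) (∑-*ˡ L (+ 1 / N) f)

  uniform-isDistribution : (L : List A) → length L ≡ N → IsDistribution (uniform L)
  uniform-isDistribution L |L|≡N = all-0≤ L , (begin
    ∑ (uniform L) proj₁        ≡⟨ ∑-map L _ proj₁ ⟩
    ∑[ x ∈ L ] (+ 1 / N)        ≡⟨ ∑-const L (+ 1 / N) ⟩
    (+ 1 / N) ℚ.* nat (length L) ≡⟨ cong (λ k → (+ 1 / N) ℚ.* nat k) |L|≡N ⟩
    (+ 1 / N) ℚ.* nat N          ≡⟨ 1/N*N≡1 N ⟩
    1ℚ                           ∎)
    where
    open ≡-Reasoning
    all-0≤ : (L : List A) → All (λ p → 0ℚ ℚ.≤ proj₁ p) (uniform L)
    all-0≤ []      = []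
    all-0≤ (x ∷ L) = 0≤1/N N ∷ all-0≤ L

isValue-fromSaddlePoint : ∀ {n m} .{{_ : NonZero n}} {v : ℚ}
  (μ : Mixed (EloisePure n m)) (ν : Mixed (AbelardPure n m)) →
  IsDistribution μ → IsDistribution ν →
  (∀ a → v ℚ.≤ 𝔼 μ (λ e → payoff e a)) → (∀ e → 𝔼 ν (payoff e) ℚ.≤ v) →
  IsValue n m v
isValue-fromSaddlePoint μ ν μ-dist ν-dist μ-secures ν-secures =
  (μ , μ-dist , λ ν′ ν′-dist →
     subst (_ ℚ.≤_) (sym (𝔼₂-iterateʳ μ ν′ payoff)) (𝔼-lowerBound ν′ ν′-dist μ-secures)) ,
  (λ μ′ μ′-dist → ν , ν-dist ,
     subst (ℚ._≤ _) (sym (𝔼₂-iterateˡ μ′ ν payoff)) (𝔼-upperBound μ′ μ′-dist ν-secures))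

-- The cyclic group ℤ/n on Fin n

module _ {n : ℕ} .{{_ : NonZero n}} where

  toℕ-⊕ : (a b : Fin n) → toℕ (a ⊕ b) ≡ (toℕ a ℕ.+ toℕ b) % n
  toℕ-⊕ a b = FinP.toℕ-fromℕ< (m%n<n (toℕ a ℕ.+ toℕ b) n)

  ⊕-comm : (a b : Fin n) → a ⊕ b ≡ b ⊕ a
  ⊕-comm a b = FinP.toℕ-injective (trans (toℕ-⊕ a b)
    (trans (cong (_% n) (ℕP.+-comm (toℕ a) (toℕ b))) (sym (toℕ-⊕ b a))))

  %-absorbˡ : ∀ x y → (x % n ℕ.+ y) % n ≡ (x ℕ.+ y) % n
  %-absorbˡ x y = begin
    (x % n ℕ.+ y) % n           ≡⟨ %-distribˡ-+ (x % n) y n ⟩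
    (x % n % n ℕ.+ y % n) % n   ≡⟨ cong (λ z → (z ℕ.+ y % n) % n) (m%n%n≡m%n x n) ⟩
    (x % n ℕ.+ y % n) % n       ≡⟨ %-distribˡ-+ x y n ⟨
    (x ℕ.+ y) % n               ∎
    where open ≡-Reasoning

  %-absorbʳ : ∀ x y → (x ℕ.+ y % n) % n ≡ (x ℕ.+ y) % n
  %-absorbʳ x y = trans (cong (_% n) (ℕP.+-comm x (y % n)))
    (trans (%-absorbˡ y x) (cong (_% n) (ℕP.+-comm y x)))

  [n+x]%n≡x : (x : Fin n) → (n ℕ.+ toℕ x) % n ≡ toℕ x
  [n+x]%n≡x x = trans (cong (_% n) (ℕP.+-comm n (toℕ x)))
    (trans ([m+n]%n≡m%n (toℕ x) n) (m<n⇒m%n≡m (FinP.toℕ<n x)))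

  infix 21 ⊖_
  ⊖_ : Fin n → Fin n
  ⊖ k = fromℕ< (m%n<n (n ∸ toℕ k) n)

  toℕ-⊖⊕ : (k x : Fin n) → toℕ (⊖ k ⊕ x) ≡ ((n ∸ toℕ k) ℕ.+ toℕ x) % n
  toℕ-⊖⊕ k x = trans (toℕ-⊕ (⊖ k) x)
    (trans (cong (λ z → (z ℕ.+ toℕ x) % n) (FinP.toℕ-fromℕ< _)) (%-absorbˡ (n ∸ toℕ k) (toℕ x)))

  ⊖-inverseˡ : (k x : Fin n) → ⊖ k ⊕ (k ⊕ x) ≡ x
  ⊖-inverseˡ k x = FinP.toℕ-injective (begin
    toℕ (⊖ k ⊕ (k ⊕ x))           ≡⟨ toℕ-⊖⊕ k (k ⊕ x) ⟩
    ((n ∸ i) ℕ.+ toℕ (k ⊕ x)) % n ≡⟨ cong (λ z → ((n ∸ i) ℕ.+ z) % n) (toℕ-⊕ k x) ⟩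
    ((n ∸ i) ℕ.+ (i ℕ.+ j) % n) % n ≡⟨ %-absorbʳ (n ∸ i) (i ℕ.+ j) ⟩
    ((n ∸ i) ℕ.+ (i ℕ.+ j)) % n   ≡⟨ cong (_% n) (ℕP.+-assoc (n ∸ i) i j) ⟨
    ((n ∸ i) ℕ.+ i ℕ.+ j) % n     ≡⟨ cong (λ z → (z ℕ.+ j) % n) (ℕP.m∸n+n≡m (FinP.toℕ≤n k)) ⟩
    (n ℕ.+ j) % n                 ≡⟨ [n+x]%n≡x x ⟩
    j                             ∎)
    where
    open ≡-Reasoning
    i j : ℕ
    i = toℕ k
    j = toℕ x

  ⊖-inverseʳ : (k x : Fin n) → k ⊕ (⊖ k ⊕ x) ≡ x
  ⊖-inverseʳ k x = FinP.toℕ-injective (begin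
    toℕ (k ⊕ (⊖ k ⊕ x))           ≡⟨ toℕ-⊕ k (⊖ k ⊕ x) ⟩
    (i ℕ.+ toℕ (⊖ k ⊕ x)) % n     ≡⟨ cong (λ z → (i ℕ.+ z) % n) (toℕ-⊖⊕ k x) ⟩
    (i ℕ.+ ((n ∸ i) ℕ.+ j) % n) % n ≡⟨ %-absorbʳ i ((n ∸ i) ℕ.+ j) ⟩
    (i ℕ.+ ((n ∸ i) ℕ.+ j)) % n   ≡⟨ cong (_% n) (ℕP.+-assoc i (n ∸ i) j) ⟨
    (i ℕ.+ (n ∸ i) ℕ.+ j) % n     ≡⟨ cong (λ z → (z ℕ.+ j) % n) (ℕP.m+[n∸m]≡n (FinP.toℕ≤n k)) ⟩
    (n ℕ.+ j) % n                 ≡⟨ [n+x]%n≡x x ⟩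
    j                             ∎)
    where
    open ≡-Reasoning
    i j : ℕ
    i = toℕ k
    j = toℕ x

  ⊕-permutation : Fin n → Permutation′ n
  ⊕-permutation k = permutation (k ⊕_) (⊖ k ⊕_) (⊖-inverseʳ k) (⊖-inverseˡ k)

∑-tabulate : {A : Set} {n : ℕ} (f : Fin n → A) (g : A → ℚ) →
             ∑ (List.tabulate f) g ≡ sum (g ∘ f)
∑-tabulate {n = zero}  f g = refl
∑-tabulate {n = suc n} f g = cong (g (f Fin.zero) ℚ.+_) (∑-tabulate (f ∘ Fin.suc) g)

∑-allFin-translate : {n : ℕ} .{{_ : NonZero n}} (k : Fin n) (g : Fin n → ℚ) →
                     ∑[ x ∈ allFin n ] g (k ⊕ x) ≡ ∑ (allFin n) g
∑-allFin-translate {n} k g = begin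
  ∑[ x ∈ allFin n ] g (k ⊕ x) ≡⟨ ∑-tabulate (λ x → x) (g ∘ (k ⊕_)) ⟩
  sum (g ∘ (k ⊕_))           ≡⟨ sum-permute g (⊕-permutation k) ⟨
  sum g                      ≡⟨ ∑-tabulate (λ x → x) g ⟨
  ∑ (allFin n) g             ∎
  where open ≡-Reasoning

∑-allSeqs-suc : ∀ {n m} (F : Vec (Fin n) (suc m) → ℚ) →
                ∑ (allSeqs n (suc m)) F ≡ ∑[ x ∈ allFin n ] ∑[ s ∈ allSeqs n m ] F (x ∷ s)
∑-allSeqs-suc {n} {m} F = trans (∑-concatMap (allFin n) (λ x → map (x ∷_) (allSeqs n m)) F)
  (∑-cong (allFin n) (λ x → ∑-map (allSeqs n m) (x ∷_) F))

length-allSeqs : ∀ n m → length (allSeqs n m) ≡ n ^ m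
length-allSeqs n zero    = refl
length-allSeqs n (suc m) = begin
  length (allSeqs n (suc m))      ≡⟨ length-concatMap-const (allFin n) _ (λ x →
                                       trans (ListP.length-map (x ∷_) (allSeqs n m)) (length-allSeqs n m)) ⟩
  length (allFin n) ℕ.* n ^ m     ≡⟨ cong (ℕ._* n ^ m) (ListP.length-tabulate {n = n} (λ x → x)) ⟩
  n ℕ.* n ^ m                     ∎
  where open ≡-Reasoning

module _ {n : ℕ} .{{_ : NonZero n}} where

  _⊕ᵥ_ : ∀ {m} → (Fin m → Fin n) → (Fin m → Fin n) → Vec (Fin n) m
  a ⊕ᵥ e = tabulate (λ i → a i ⊕ e i)

  ⊕ᵥ-comm : ∀ {m} (a e : Fin m → Fin n) → a ⊕ᵥ e ≡ e ⊕ᵥ a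
  ⊕ᵥ-comm a e = VecP.tabulate-cong (λ i → ⊕-comm (a i) (e i))

  ∑-allSeqs-translate : ∀ {m} (c : Fin m → Fin n) (F : Vec (Fin n) m → ℚ) →
                        ∑[ s ∈ allSeqs n m ] F (c ⊕ᵥ lookup s) ≡ ∑ (allSeqs n m) F
  ∑-allSeqs-translate {zero}  c F = refl
  ∑-allSeqs-translate {suc m} c F = begin
    ∑[ s ∈ allSeqs n (suc m) ] F (c ⊕ᵥ lookup s)
      ≡⟨ ∑-allSeqs-suc (λ s → F (c ⊕ᵥ lookup s)) ⟩
    ∑[ x ∈ allFin n ] ∑[ s ∈ allSeqs n m ] F ((c Fin.zero ⊕ x) ∷ (c ∘ Fin.suc) ⊕ᵥ lookup s)
      ≡⟨ ∑-cong (allFin n) (λ x → ∑-allSeqs-translate (c ∘ Fin.suc) (λ s → F ((c Fin.zero ⊕ x) ∷ s))) ⟩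
    ∑[ x ∈ allFin n ] G (c Fin.zero ⊕ x)
      ≡⟨ ∑-allFin-translate (c Fin.zero) G ⟩
    ∑ (allFin n) G
      ≡⟨ ∑-allSeqs-suc F ⟨
    ∑ (allSeqs n (suc m)) F
      ∎
    where
    open ≡-Reasoning
    G : Fin n → ℚ
    G x = ∑[ s ∈ allSeqs n m ] F (x ∷ s)

module _ {n m : ℕ} .{{_ : NonZero n}} where

  private
    instance
      n^m≢0 : NonZero (n ^ m)
      n^m≢0 = ℕP.m^n≢0 n m

  dupProb-translate : (c : Fin m → Fin n) →
                      (+ 1 / n ^ m) ℚ.* (∑[ s ∈ allSeqs n m ] 𝟙 (hasDup (c ⊕ᵥ lookup s))) ≡ dupProb n m
  dupProb-translate c = begin
    (+ 1 / n ^ m) ℚ.* (∑[ s ∈ allSeqs n m ] 𝟙 (hasDup (c ⊕ᵥ lookup s)))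
      ≡⟨ cong ((+ 1 / n ^ m) ℚ.*_) (∑-allSeqs-translate c (𝟙 ∘ hasDup)) ⟩
    (+ 1 / n ^ m) ℚ.* (∑[ s ∈ allSeqs n m ] 𝟙 (hasDup s))
      ≡⟨ cong ((+ 1 / n ^ m) ℚ.*_) (∑-𝟙 (allSeqs n m) hasDup) ⟩
    (+ 1 / n ^ m) ℚ.* nat (dupCount n m)
      ≡⟨ /-as-scaling (dupCount n m) (n ^ m) ⟨
    dupProb n m
      ∎
    where open ≡-Reasoning

-- Duplicates and Eloise's selector

IsDuplicatePair : {A : Set} {k : ℕ} → (Fin k → A) → Fin k × Fin k → Set
IsDuplicatePair f (i , j) = i Fin.< j × f i ≡ f j

module _ {n : ℕ} where

  anyEq-tabulate-sound : ∀ {k} (x : Fin n) (g : Fin k → Fin n) →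
                         anyEq x (tabulate g) ≡ true → ∃ λ j → x ≡ g j
  anyEq-tabulate-sound {suc k} x g any with x ≟F g Fin.zero
  ... | yes x≡g₀ = Fin.zero , x≡g₀
  ... | no _     = let j , x≡gj = anyEq-tabulate-sound x (g ∘ Fin.suc) any in Fin.suc j , x≡gj

  anyEq-tabulate-complete : ∀ {k} (x : Fin n) (g : Fin k → Fin n) (j : Fin k) →
                            x ≡ g j → anyEq x (tabulate g) ≡ true
  anyEq-tabulate-complete x g Fin.zero x≡g₀ with x ≟F g Fin.zero
  ... | yes _   = refl
  ... | no x≢g₀ = ⊥-elim (x≢g₀ x≡g₀)
  anyEq-tabulate-complete x g (Fin.suc j) x≡gj with x ≟F g Fin.zero
  ... | yes _ = refl
  ... | no _  = anyEq-tabulate-complete x (g ∘ Fin.suc) j x≡gj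

  hasDup-tabulate-sound : ∀ {k} (f : Fin k → Fin n) →
                          hasDup (tabulate f) ≡ true → ∃ (IsDuplicatePair f)
  hasDup-tabulate-sound {suc k} f dup with anyEq (f Fin.zero) (tabulate (f ∘ Fin.suc)) in any
  ... | true  = let j , f₀≡fj = anyEq-tabulate-sound (f Fin.zero) (f ∘ Fin.suc) any
                in (Fin.zero , Fin.suc j) , ℕ.s≤s ℕ.z≤n , f₀≡fj
  ... | false = let (i , j) , i<j , fi≡fj = hasDup-tabulate-sound (f ∘ Fin.suc) dup
                in (Fin.suc i , Fin.suc j) , ℕ.s≤s i<j , fi≡fj

  hasDup-tabulate-complete : ∀ {k} (f : Fin k → Fin n) (d : Fin k × Fin k) →
                             IsDuplicatePair f d → hasDup (tabulate f) ≡ true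
  hasDup-tabulate-complete f (Fin.zero , Fin.suc j) (_ , f₀≡fj)
    rewrite anyEq-tabulate-complete (f Fin.zero) (f ∘ Fin.suc) j f₀≡fj = refl
  hasDup-tabulate-complete f (Fin.suc i , Fin.suc j) (ℕ.s≤s i<j , fi≡fj) =
    trans (cong (anyEq (f Fin.zero) (tabulate (f ∘ Fin.suc)) ∨_)
                (hasDup-tabulate-complete (f ∘ Fin.suc) (i , j) (i<j , fi≡fj)))
          (∨-zeroʳ _)

module _ {n : ℕ} .{{_ : NonZero n}} {m : ℕ} (a e : Fin m → Fin n) where

  disjTrue-sound : (d : Disjunct m) → disjTrue a e d ≡ true → IsDuplicatePair (λ i → a i ⊕ e i) d
  disjTrue-sound (i , j) _ with i Fin.<? j | a i ⊕ e i ≟F a j ⊕ e j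
  ... | yes i<j | yes eq = i<j , eq

  disjTrue-complete : (d : Disjunct m) → IsDuplicatePair (λ i → a i ⊕ e i) d → disjTrue a e d ≡ true
  disjTrue-complete (i , j) (i<j , eq) with i Fin.<? j | a i ⊕ e i ≟F a j ⊕ e j
  ... | yes _ | yes _   = refl
  ... | no i≮j | _      = ⊥-elim (i≮j i<j)
  ... | yes _ | no neq  = ⊥-elim (neq eq)

  payoff-≤-𝟙-hasDup : (sel : (Fin m → Fin n) → (Fin m → Fin n) → Disjunct m) →
                      payoff (e , sel) a ℚ.≤ 𝟙 (hasDup (a ⊕ᵥ e))
  payoff-≤-𝟙-hasDup sel =
    𝟙-mono (hasDup-tabulate-complete _ (sel a e) ∘ disjTrue-sound (sel a e))

module _ {n k : ℕ} .{{_ : NonZero n}} where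

  -- The equation is an argument, rather than a `with … in`, so that lemmas can
  -- case on b; the fallback (0 , 0) is a false disjunct because 0 ≮ 0.
  duplicatePairGiven : (f : Fin (suc k) → Fin n) (b : Bool) → hasDup (tabulate f) ≡ b → Disjunct (suc k)
  duplicatePairGiven f true  dup = proj₁ (hasDup-tabulate-sound f dup)
  duplicatePairGiven f false _   = Fin.zero , Fin.zero

  duplicateSelector : (Fin (suc k) → Fin n) → (Fin (suc k) → Fin n) → Disjunct (suc k)
  duplicateSelector a e = duplicatePairGiven (λ i → a i ⊕ e i) (hasDup (a ⊕ᵥ e)) refl

  disjTrue-duplicatePairGiven : (a e : Fin (suc k) → Fin n) (b : Bool) (dup : hasDup (a ⊕ᵥ e) ≡ b) →
                                disjTrue a e (duplicatePairGiven (λ i → a i ⊕ e i) b dup) ≡ b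
  disjTrue-duplicatePairGiven a e true  dup = disjTrue-complete a e _ (proj₂ (hasDup-tabulate-sound _ dup))
  disjTrue-duplicatePairGiven a e false _   = refl

  payoff-duplicateSelector : (a e : Fin (suc k) → Fin n) →
                             payoff (e , duplicateSelector) a ≡ 𝟙 (hasDup (a ⊕ᵥ e))
  payoff-duplicateSelector a e = cong 𝟙 (disjTrue-duplicatePairGiven a e _ refl)

-- The uniform saddle point

module _ {n k : ℕ} .{{_ : NonZero n}} where

  private
    instance
      n^m≢0 : NonZero (n ^ suc k)
      n^m≢0 = ℕP.m^n≢0 n (suc k)

    samples : List (Vec (Fin n) (suc k))
    samples = allSeqs n (suc k)

    w : ℚ
    w = + 1 / n ^ suc k

    eloisePures : List (EloisePure n (suc k))
    eloisePures = map (λ s → lookup s , duplicateSelector) samples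

  eloiseUniform : Mixed (EloisePure n (suc k))
  eloiseUniform = uniform (n ^ suc k) eloisePures

  abelardUniform : Mixed (AbelardPure n (suc k))
  abelardUniform = uniform (n ^ suc k) (map lookup samples)

  eloiseUniform-isDistribution : IsDistribution eloiseUniform
  eloiseUniform-isDistribution = uniform-isDistribution (n ^ suc k) eloisePures
    (trans (ListP.length-map _ samples) (length-allSeqs n (suc k)))

  abelardUniform-isDistribution : IsDistribution abelardUniform
  abelardUniform-isDistribution = uniform-isDistribution (n ^ suc k) (map lookup samples)
    (trans (ListP.length-map lookup samples) (length-allSeqs n (suc k)))

  eloiseUniform-secures : (a : AbelardPure n (suc k)) →
                          𝔼 eloiseUniform (λ e → payoff e a) ≡ dupProb n (suc k)
  eloiseUniform-secures a = begin
    𝔼 eloiseUniform (λ e → payoff e a)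
      ≡⟨ 𝔼-uniform (n ^ suc k) eloisePures (λ e → payoff e a) ⟩
    w ℚ.* (∑[ e ∈ eloisePures ] payoff e a)
      ≡⟨ cong (w ℚ.*_) (trans (∑-map samples _ (λ e → payoff e a))
           (∑-cong samples (λ s → payoff-duplicateSelector a (lookup s)))) ⟩
    w ℚ.* (∑[ s ∈ samples ] 𝟙 (hasDup (a ⊕ᵥ lookup s)))
      ≡⟨ dupProb-translate a ⟩
    dupProb n (suc k)
      ∎
    where open ≡-Reasoning

  abelardUniform-secures : (p : EloisePure n (suc k)) →
                           𝔼 abelardUniform (payoff p) ℚ.≤ dupProb n (suc k)
  abelardUniform-secures (e , sel) = begin
    𝔼 abelardUniform (payoff (e , sel))
      ≤⟨ 𝔼-mono abelardUniform abelardUniform-isDistribution (λ a → payoff-≤-𝟙-hasDup a e sel) ⟩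
    𝔼 abelardUniform (λ a → 𝟙 (hasDup (a ⊕ᵥ e)))
      ≡⟨ 𝔼-uniform (n ^ suc k) (map lookup samples) (λ a → 𝟙 (hasDup (a ⊕ᵥ e))) ⟩
    w ℚ.* (∑[ a ∈ map lookup samples ] 𝟙 (hasDup (a ⊕ᵥ e)))
      ≡⟨ cong (w ℚ.*_) (trans (∑-map samples lookup (λ a → 𝟙 (hasDup (a ⊕ᵥ e))))
           (∑-cong samples (λ s → cong (𝟙 ∘ hasDup) (⊕ᵥ-comm (lookup s) e)))) ⟩
    w ℚ.* (∑[ s ∈ samples ] 𝟙 (hasDup (e ⊕ᵥ lookup s)))
      ≡⟨ dupProb-translate e ⟩
    dupProb n (suc k)
      ∎
    where open ℚP.≤-Reasoning

proposition6 : (n m : ℕ) .{{_ : NonZero n}} → 1 ≤ m → IsValue n m (dupProb n m)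
proposition6 n zero    ()
proposition6 n (suc k) _ = isValue-fromSaddlePoint eloiseUniform abelardUniform
  eloiseUniform-isDistribution abelardUniform-isDistribution
  (λ a → ℚP.≤-reflexive (sym (eloiseUniform-secures a)))
  abelardUniform-secures
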